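{- Let $T$ be a normal $\omega_1$-tree and $n\ge1$. Then every derived tree of $T$ with dimension $n+1$ is a subtree of some derived tree $T_{\vec a}$ where $\vec a\in T^{n+1}$ is minimal.
   Context: $T^{n+1}$ is the set of tuples $(c_0,\dots,c_n)$ of elements of $T$ all of the same height (the height of the tuple); $\vec c\upharpoonright\beta$ denotes the tuple of predecessors at height $\beta$. An injective tuple $\vec a\in T^{n+1}$ of height $\alpha$ is minimal if $\vec a\upharpoonright\beta$ is not injective for every $\beta<\alpha$. For an injective tuple $\vec b\in T^{n+1}$, the derived tree $T_{\vec b}$ (of dimension $n+1$) is the set of $\vec c\in T^{n+1}$ with $b_i\le_T c_i$ for all $i$, ordered componentwise. Normal: has a root, each element has at least two immediate successors, each element has elements above it at every higher level, distinct elements of the same limit height have different predecessor sets. -}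

module Defs where

open import Data.Nat using (ℕ)
open import Data.Fin using (Fin)
open import Data.Product using (Σ; Σ-syntax; ∃; ∃-syntax; _×_; _,_)
open import Data.Sum using (_⊎_)
open import Relation.Nullary using (¬_)
open import Relation.Binary.PropositionalEquality using (_≡_; _≢_)
open import Relation.Binary.Definitions using (Trichotomous; Transitive)
open import Induction.WellFounded using (WellFounded)
open import Function.Definitions using (Injective)
open import Function.Bundles using (_⇔_)

-- Heights live in a well-ordered set (Ht, <ʰ) of order type ω₁:
-- a strict well-order all of whose proper initial segments are countable
-- but which is itself uncountable.  The height of a node is the order type
-- of its set of predecessors: the predecessors of t are exactly one node of
-- each height below ht t (so they are well-ordered of type ht t).
record ω₁-Tree : Set₁ where
  field
    Node  : Set
    _<ᵀ_  : Node → Node → Set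
    Ht    : Set
    _<ʰ_  : Ht → Ht → Set
    ht    : Node → Ht
    <ʰ-trans   : Transitive _<ʰ_
    <ʰ-tri     : Trichotomous _≡_ _<ʰ_
    <ʰ-wf      : WellFounded _<ʰ_
    Ht-segments-countable :
      ∀ α → Σ[ f ∈ (Σ[ β ∈ Ht ] (β <ʰ α) → ℕ) ] Injective _≡_ _≡_ f
    Ht-uncountable : ¬ (Σ[ g ∈ (ℕ → Ht) ] (∀ α → ∃[ k ] g k ≡ α))
    <ᵀ-trans   : Transitive _<ᵀ_
    <ᵀ-ht      : ∀ {s t} → s <ᵀ t → ht s <ʰ ht t
    pred-exists : ∀ t β → β <ʰ ht t → Σ[ s ∈ Node ] (s <ᵀ t × ht s ≡ β)
    pred-unique : ∀ {s s' t} → s <ᵀ t → s' <ᵀ t → ht s ≡ ht s' → s ≡ s'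
    levels-nonempty  : ∀ α → Σ[ t ∈ Node ] ht t ≡ α
    levels-countable :
      ∀ α → Σ[ f ∈ (Σ[ t ∈ Node ] (ht t ≡ α) → ℕ) ] Injective _≡_ _≡_ f

  _≤ᵀ_ : Node → Node → Set
  s ≤ᵀ t = s ≡ t ⊎ s <ᵀ t

  IsLimit : Ht → Set
  IsLimit α = (∃[ β ] β <ʰ α) × (∀ β → β <ʰ α → ∃[ γ ] (β <ʰ γ × γ <ʰ α))

  ImmSucc : Node → Node → Set
  ImmSucc t t' = t <ᵀ t' × ¬ (∃[ u ] (t <ᵀ u × u <ᵀ t'))

  record Tuple (n : ℕ) : Set where
    constructor tuple
    field
      elems  : Fin n → Node
      height : Ht
      same-height : ∀ i → ht (elems i) ≡ height

  open Tuple public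

  InjectiveTuple : ∀ {n} → Tuple n → Set
  InjectiveTuple c = Injective _≡_ _≡_ (elems c)

  -- d = c ↾ β  (d consists of the predecessors of c at height β = height d)
  IsRestrictionOf : ∀ {n} → Tuple n → Tuple n → Set
  IsRestrictionOf d c = ∀ i → elems d i ≤ᵀ elems c i

  Minimal : ∀ {n} → Tuple n → Set
  Minimal a = InjectiveTuple a ×
    (∀ d → IsRestrictionOf d a → height d <ʰ height a → ¬ InjectiveTuple d)

  _∈Derived_ : ∀ {n} → Tuple n → Tuple n → Set
  c ∈Derived b = ∀ i → elems b i ≤ᵀ elems c i

  -- T_b is a subtree of T_a: T_b ⊆ T_a (both carry the componentwise order,
  -- so T_b carries the order induced from T_a)
  DerivedSubtree : ∀ {n} → Tuple n → Tuple n → Set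
  DerivedSubtree b a = ∀ c → c ∈Derived b → c ∈Derived a

  record Normal : Set where
    field
      root : Σ[ r ∈ Node ] (∀ t → r ≤ᵀ t)
      two-successors :
        ∀ t → Σ[ s₁ ∈ Node ] Σ[ s₂ ∈ Node ]
                (s₁ ≢ s₂ × ImmSucc t s₁ × ImmSucc t s₂)
      extends-to-all-levels :
        ∀ t β → ht t <ʰ β → Σ[ s ∈ Node ] (t <ᵀ s × ht s ≡ β)
      limit-separation :
        ∀ s t → ht s ≡ ht t → IsLimit (ht s) →
          (∀ u → (u <ᵀ s) ⇔ (u <ᵀ t)) → s ≡ t

-- Starting from b, keep passing to an injective restriction of strictly smaller
-- height as long as one exists (a classical case distinction).  Heights are
-- well-founded, so the descent stops at a minimal tuple a, and since a lies
-- below b componentwise, every tuple above b is above a, i.e. T_b ⊆ T_a.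
module Submission where

open import Defs
open import Level using (0ℓ)
open import Axiom.ExcludedMiddle using (ExcludedMiddle)
open import Data.Nat using (ℕ; suc; _≤_)
open import Data.Product using (Σ-syntax; _×_; _,_)
open import Data.Sum using (inj₁; inj₂)
open import Relation.Nullary using (yes; no)
open import Relation.Binary.PropositionalEquality using (refl)
open import Induction.WellFounded using (Acc; acc)

module _ (T : ω₁-Tree) where
  open ω₁-Tree T

  ≤ᵀ-trans : ∀ {s t u} → s ≤ᵀ t → t ≤ᵀ u → s ≤ᵀ u
  ≤ᵀ-trans (inj₁ refl) t≤u         = t≤u
  ≤ᵀ-trans (inj₂ s<t)  (inj₁ refl) = inj₂ s<t
  ≤ᵀ-trans (inj₂ s<t)  (inj₂ t<u)  = inj₂ (<ᵀ-trans s<t t<u)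

  restriction-trans : ∀ {m} {a b c : Tuple m} →
    IsRestrictionOf a b → IsRestrictionOf b c → IsRestrictionOf a c
  restriction-trans a↾b b↾c i = ≤ᵀ-trans (a↾b i) (b↾c i)

  restriction-refl : ∀ {m} (b : Tuple m) → IsRestrictionOf b b
  restriction-refl _ _ = inj₁ refl

  restriction⇒derivedSubtree : ∀ {m} {a b : Tuple m} →
    IsRestrictionOf a b → DerivedSubtree b a
  restriction⇒derivedSubtree {a = a} {b} a↾b c c∈T_b =
    restriction-trans {a = a} {b} {c} a↾b c∈T_b

  HasLowerInjectiveRestriction : ∀ {m} → Tuple m → Set
  HasLowerInjectiveRestriction {m} r =
    Σ[ d ∈ Tuple m ] (IsRestrictionOf d r × height d <ʰ height r × InjectiveTuple d)

  module _ (em : ExcludedMiddle 0ℓ) where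

    minimal-restriction-acc : ∀ {m} (r : Tuple m) → Acc _<ʰ_ (height r) →
      InjectiveTuple r → Σ[ a ∈ Tuple m ] (Minimal a × IsRestrictionOf a r)
    minimal-restriction-acc r (acc below) r-inj with em {HasLowerInjectiveRestriction r}
    ... | yes (d , d↾r , d<r , d-inj) =
      let a , a-min , a↾d = minimal-restriction-acc d (below d<r) d-inj
      in  a , a-min , restriction-trans {a = a} {d} {r} a↾d d↾r
    ... | no none =
      r , (r-inj , λ d d↾r d<r d-inj → none (d , d↾r , d<r , d-inj)) , restriction-refl r

    minimal-restriction : ∀ {m} (b : Tuple m) → InjectiveTuple b →
      Σ[ a ∈ Tuple m ] (Minimal a × IsRestrictionOf a b)
    minimal-restriction b = minimal-restriction-acc b (<ʰ-wf (height b))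

lemma3p3 : ExcludedMiddle 0ℓ → (T : ω₁-Tree) → ω₁-Tree.Normal T →
    (n : ℕ) → 1 ≤ n →
    (b : ω₁-Tree.Tuple T (suc n)) → ω₁-Tree.InjectiveTuple T b →
    Σ[ a ∈ ω₁-Tree.Tuple T (suc n) ]
    (ω₁-Tree.Minimal T a × ω₁-Tree.DerivedSubtree T b a)
lemma3p3 em T _ n _ b b-inj =
  let a , a-min , a↾b = minimal-restriction T em b b-inj
  in  a , a-min , restriction⇒derivedSubtree T {a = a} {b} a↾b
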